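{- Let $T=(V,A)$ be a tournament with weights $w:V\to\mathbb{Q}_{\ge0}$. Run the following procedure: set $F=\emptyset$, $T'=T$, and compute an optimal solution $x^*$ of $\mathrm{LP}(T')$. While $T'$ is nonempty and some vertex $v$ of $T'$ has $x^*_v\ge \frac37$: let $S=\{v\in V(T'): x^*_v\ge \frac37\}$, set $F:=F\cup S$ and $T':=T'-S$, then delete from $T'$ every vertex not contained in any directed triangle of $T'$, and compute an optimal solution $x^*$ of $\mathrm{LP}(T')$ for the new $T'$. Then at every iteration of this procedure (including at its termination), the current $F$ and $T'$ satisfy $$w(F)\le \frac73\bigl(OPT(T)-OPT(T')\bigr).$$
   Context: A tournament is an orientation of a complete graph; $T-S$ denotes the subtournament obtained by deleting the vertex set $S$. $\Delta(T)$ denotes the family of vertex sets of directed triangles of $T$. $\mathcal{T}_7$ is the family of $7$-vertex tournaments containing no transitive subtournament on $5$ vertices, and $\mathcal{T}_7(T)$ is the family of $7$-element vertex sets $Q$ of $T$ with $T[Q]$ isomorphic to a member of $\mathcal{T}_7$. For a tournament $T$ with vertex weights $w$, $\mathrm{LP}(T)$ is the linear program: minimize $\sum_v w(v)x_v$ subject to $x(R)\ge 1$ for all $R\in\Delta(T)$, $x(Q)\ge 3$ for all $Q\in\mathcal{T}_7(T)$, $x\ge 0$, where $x(R)=\sum_{v\in R}x_v$; $OPT(T)$ is its optimum value (which is $0$ for the empty tournament). $w(F)=\sum_{v\in F}w(v)$. -}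

module Defs where

open import Data.Nat using (ℕ)
open import Data.Bool using (if_then_else_)
open import Data.Fin using (Fin)
open import Data.Fin.Subset using (Subset; _∈_; _∉_; _⊆_; ∣_∣; ⊤; _∪_; _─_)
  renaming (⊥ to ∅)
open import Data.Vec using (Vec; foldr′; zipWith; tabulate)
open import Data.Rational using (ℚ; 0ℚ; 1ℚ; _+_; _*_; _-_; _≤_; _/_)
open import Data.Integer using (+_)
open import Data.Product using (Σ; ∃; ∃-syntax; _×_; _,_)
open import Data.Sum using (_⊎_)
open import Relation.Nullary using (¬_)
open import Relation.Binary.PropositionalEquality using (_≡_)
open import Function.Bundles using (_⇔_)

-- A tournament on the vertex set Fin n, given by its arc relation E (E a b = "a → b").
record IsTournament {n : ℕ} (E : Fin n → Fin n → Set) : Set where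
  field
    irrefl  : ∀ a → ¬ E a a
    total   : ∀ a b → ¬ (a ≡ b) → E a b ⊎ E b a
    antisym : ∀ a b → E a b → ¬ E b a

sumOver : {n : ℕ} → Subset n → (Fin n → ℚ) → ℚ
sumOver {n} U f = foldr′ _+_ 0ℚ (zipWith (λ b a → if b then a else 0ℚ) U (tabulate f))

DirTriangle : {n : ℕ} → (Fin n → Fin n → Set) → Subset n → Fin n → Fin n → Fin n → Set
DirTriangle E U a b c = a ∈ U × b ∈ U × c ∈ U × E a b × E b c × E c a

InTriangle : {n : ℕ} → (Fin n → Fin n → Set) → Subset n → Fin n → Set
InTriangle E U v = ∃[ b ] ∃[ c ] DirTriangle E U v b c

IsTransitiveOn : {n : ℕ} → (Fin n → Fin n → Set) → Subset n → Set
IsTransitiveOn E P = ∀ a b c → a ∈ P → b ∈ P → c ∈ P → E a b → E b c → E a c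

InT7 : {n : ℕ} → (Fin n → Fin n → Set) → Subset n → Subset n → Set
InT7 E U Q = Q ⊆ U × ∣ Q ∣ ≡ 7 × ¬ (∃[ P ] (P ⊆ Q × ∣ P ∣ ≡ 5 × IsTransitiveOn E P))

-- Feasibility for LP(T[U]) (only coordinates of vertices in U are relevant).
Feasible : {n : ℕ} → (Fin n → Fin n → Set) → Subset n → (Fin n → ℚ) → Set
Feasible E U x =
  (∀ v → v ∈ U → 0ℚ ≤ x v) ×
  (∀ a b c → DirTriangle E U a b c → 1ℚ ≤ x a + x b + x c) ×
  (∀ Q → InT7 E U Q → + 3 / 1 ≤ sumOver Q x)

objective : {n : ℕ} → (Fin n → ℚ) → Subset n → (Fin n → ℚ) → ℚ
objective w U x = sumOver U (λ v → w v * x v)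

-- x is an optimal solution of LP(T[U]) (its objective value is OPT(T[U])).
Optimal : {n : ℕ} → (Fin n → Fin n → Set) → (Fin n → ℚ) → Subset n → (Fin n → ℚ) → Set
Optimal E w U x = Feasible E U x × (∀ y → Feasible E U y → objective w U x ≤ objective w U y)

record State (n : ℕ) : Set where
  constructor state
  field
    F     : Subset n
    U     : Subset n       -- vertex set of the current T'
    xstar : Fin n → ℚ

data Step {n : ℕ} (E : Fin n → Fin n → Set) (w : Fin n → ℚ) : State n → State n → Set where
  step : ∀ {F U x} (S U' : Subset n) (x' : Fin n → ℚ)
    → (∃[ v ] (v ∈ U))
    → (∃[ v ] (v ∈ U × + 3 / 7 ≤ x v))
    → (∀ v → (v ∈ S ⇔ (v ∈ U × + 3 / 7 ≤ x v)))
    → (∀ v → (v ∈ U' ⇔ (v ∈ (U ─ S) × InTriangle E (U ─ S) v)))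
    → Optimal E w U' x'
    → Step E w (state F U x) (state (F ∪ S) U' x')

data Reachable {n : ℕ} (E : Fin n → Fin n → Set) (w : Fin n → ℚ) (s₀ : State n) : State n → Set where
  here : Reachable E w s₀ s₀
  next : ∀ {s s'} → Reachable E w s₀ s → Step E w s s' → Reachable E w s₀ s'

initial : {n : ℕ} → (Fin n → ℚ) → State n
initial x₀ = state ∅ ⊤ x₀

module Submission where

-- Along any run of the procedure we maintain the invariant
--   x* is feasible for LP(T')   and   w(F) ≤ 7/3 · (OPT(T) − w·x*|_{T'}),
-- where w·x*|_{T'} = Σ_{v ∈ V(T')} w(v) x*_v is OPT(T') because x* is optimal.
-- In one step the removed set S and the new vertex set U' are disjoint parts
-- of the old vertex set U, and x* ≥ 3/7 on S, so
--   3/7 · w(S) + Σ_{U'} w x* ≤ Σ_U w x*.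
-- Moreover x* restricted to U' is feasible for LP(T[U']) (feasibility passes to
-- subtournaments), hence OPT(T[U']) ≤ Σ_{U'} w x*.  Therefore
-- w(S) ≤ 7/3 · (OPT(T[U]) − OPT(T[U'])), and since w(F ∪ S) ≤ w(F) + w(S)
-- the bound telescopes.

open import Defs
open import Data.Nat as ℕ using (ℕ)
open import Data.Bool using (Bool; true; false; _∨_; _∧_; if_then_else_)
open import Data.Fin using (Fin; zero; suc)
open import Data.Fin.Subset using (Subset; _∈_; _∉_; _⊆_; ⊤; _∪_; _∩_; _─_) renaming (⊥ to ∅)
open import Data.Fin.Subset.Properties
  using (∉⊥; drop-∷-⊆; p─q⊆p; x∈p∪q⁻; x∈p∩q⁻)
open import Data.Vec using ([]; _∷_; here; there)
open import Data.Rational using (ℚ; 0ℚ; 1ℚ; _+_; _*_; _-_; -_; _≤_; _/_; NonNegative; nonNegative)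
open import Data.Rational.Properties
open import Data.Integer using (+_)
open import Data.Empty using (⊥-elim)
open import Data.Product using (_×_; _,_; proj₁; proj₂)
open import Data.Sum using ([_,_])
open import Function using (_∘_)
open import Function.Bundles using (Equivalence)
open import Relation.Binary.PropositionalEquality
  using (_≡_; refl; sym; trans; cong; cong₂; subst; module ≡-Reasoning)
open import Algebra.Bundles using (CommutativeMonoid)
open import Algebra.Properties.CommutativeSemigroup
  (CommutativeMonoid.commutativeSemigroup +-0-commutativeMonoid) using (interchange)

∈─⇒∉ : ∀ {n} {x : Fin n} (p q : Subset n) → x ∈ p ─ q → x ∉ q
∈─⇒∉ (true ∷ p) (false ∷ q) here     ()
∈─⇒∉ (_ ∷ p)    (_ ∷ q)    (there i) (there j) = ∈─⇒∉ p q i j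

sumOver-∅ : ∀ {n} (f : Fin n → ℚ) → sumOver ∅ f ≡ 0ℚ
sumOver-∅ {ℕ.zero}  f = refl
sumOver-∅ {ℕ.suc n} f = trans (+-identityˡ _) (sumOver-∅ (f ∘ suc))

sumOver-∪-∩ : ∀ {n} (A B : Subset n) (f : Fin n → ℚ) →
              sumOver (A ∪ B) f + sumOver (A ∩ B) f ≡ sumOver A f + sumOver B f
sumOver-∪-∩ []      []      f = refl
sumOver-∪-∩ (a ∷ A) (b ∷ B) f = begin
  (pick (a ∨ b) + rest (A ∪ B)) + (pick (a ∧ b) + rest (A ∩ B))
    ≡⟨ interchange (pick (a ∨ b)) (rest (A ∪ B)) (pick (a ∧ b)) (rest (A ∩ B)) ⟩
  (pick (a ∨ b) + pick (a ∧ b)) + (rest (A ∪ B) + rest (A ∩ B))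
    ≡⟨ cong₂ _+_ (head a b) (sumOver-∪-∩ A B (f ∘ suc)) ⟩
  (pick a + pick b) + (rest A + rest B)
    ≡⟨ interchange (pick a) (pick b) (rest A) (rest B) ⟩
  (pick a + rest A) + (pick b + rest B) ∎
  where
  open ≡-Reasoning
  pick : Bool → ℚ
  pick c = if c then f zero else 0ℚ
  rest : Subset _ → ℚ
  rest C = sumOver C (f ∘ suc)
  head : ∀ a b → pick (a ∨ b) + pick (a ∧ b) ≡ pick a + pick b
  head true  true  = refl
  head true  false = refl
  head false true  = +-comm (f zero) 0ℚ
  head false false = refl

sumOver-mono : ∀ {n} (A U : Subset n) (f : Fin n → ℚ) →
               A ⊆ U → (∀ v → v ∈ U → 0ℚ ≤ f v) → sumOver A f ≤ sumOver U f
sumOver-mono [] [] f A⊆U f≥0 = ≤-refl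
sumOver-mono (a ∷ A) (u ∷ U) f A⊆U f≥0 = +-mono-≤ (head a u A⊆U (f≥0 zero)) tail
  where
  tail : sumOver A (f ∘ suc) ≤ sumOver U (f ∘ suc)
  tail = sumOver-mono A U (f ∘ suc) (drop-∷-⊆ A⊆U) (λ v → f≥0 (suc v) ∘ there)
  head : ∀ a u → (a ∷ A) ⊆ (u ∷ U) → (zero ∈ (u ∷ U) → 0ℚ ≤ f zero) →
         (if a then f zero else 0ℚ) ≤ (if u then f zero else 0ℚ)
  head true  true  _   _     = ≤-refl
  head true  false sub _     with sub here
  ... | ()
  head false true  _   f0≥0 = f0≥0 here
  head false false _   _     = ≤-refl

sumOver-nonNeg : ∀ {n} (A : Subset n) (f : Fin n → ℚ) →
                 (∀ v → v ∈ A → 0ℚ ≤ f v) → 0ℚ ≤ sumOver A f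
sumOver-nonNeg A f f≥0 =
  subst (_≤ sumOver A f) (sumOver-∅ f) (sumOver-mono ∅ A f (λ v∈∅ → ⊥-elim (∉⊥ v∈∅)) f≥0)

sumOver-∪-≤ : ∀ {n} (A B : Subset n) (f : Fin n → ℚ) → (∀ v → 0ℚ ≤ f v) →
              sumOver (A ∪ B) f ≤ sumOver A f + sumOver B f
sumOver-∪-≤ A B f f≥0 = begin
  sumOver (A ∪ B) f                        ≡⟨ +-identityʳ _ ⟨
  sumOver (A ∪ B) f + 0ℚ                   ≤⟨ +-monoʳ-≤ (sumOver (A ∪ B) f) (sumOver-nonNeg (A ∩ B) f (λ v _ → f≥0 v)) ⟩
  sumOver (A ∪ B) f + sumOver (A ∩ B) f    ≡⟨ sumOver-∪-∩ A B f ⟩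
  sumOver A f + sumOver B f                ∎
  where open ≤-Reasoning

sumOver-disjoint-≤ : ∀ {n} (A B U : Subset n) (f : Fin n → ℚ) →
                     A ⊆ U → B ⊆ U → (∀ {v} → v ∈ A → v ∉ B) →
                     (∀ v → v ∈ U → 0ℚ ≤ f v) →
                     sumOver A f + sumOver B f ≤ sumOver U f
sumOver-disjoint-≤ A B U f A⊆U B⊆U disjoint f≥0 = begin
  sumOver A f + sumOver B f                ≡⟨ sumOver-∪-∩ A B f ⟨
  sumOver (A ∪ B) f + sumOver (A ∩ B) f    ≤⟨ +-mono-≤ union-≤ intersection-≤ ⟩
  sumOver U f + 0ℚ                         ≡⟨ +-identityʳ _ ⟩
  sumOver U f                              ∎
  where
  open ≤-Reasoning
  union-≤ : sumOver (A ∪ B) f ≤ sumOver U f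
  union-≤ = sumOver-mono (A ∪ B) U f (λ {v} v∈A∪B → [ A⊆U , B⊆U ] (x∈p∪q⁻ A B v∈A∪B)) f≥0
  intersection-≤ : sumOver (A ∩ B) f ≤ 0ℚ
  intersection-≤ = subst (sumOver (A ∩ B) f ≤_) (sumOver-∅ f)
    (sumOver-mono (A ∩ B) ∅ f
      (λ v∈A∩B → let (v∈A , v∈B) = x∈p∩q⁻ A B v∈A∩B in ⊥-elim (disjoint v∈A v∈B))
      (λ v v∈∅ → ⊥-elim (∉⊥ v∈∅)))

sumOver-mono-≤ : ∀ {n} (A : Subset n) (g f : Fin n → ℚ) →
                 (∀ v → v ∈ A → g v ≤ f v) → sumOver A g ≤ sumOver A f
sumOver-mono-≤ []          g f g≤f = ≤-refl
sumOver-mono-≤ (true ∷ A)  g f g≤f =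
  +-mono-≤ (g≤f zero here) (sumOver-mono-≤ A _ _ (λ v → g≤f (suc v) ∘ there))
sumOver-mono-≤ (false ∷ A) g f g≤f =
  +-monoʳ-≤ 0ℚ (sumOver-mono-≤ A _ _ (λ v → g≤f (suc v) ∘ there))

sumOver-scale : ∀ {n} (A : Subset n) (c : ℚ) (f : Fin n → ℚ) →
                sumOver A (λ v → c * f v) ≡ c * sumOver A f
sumOver-scale []          c f = sym (*-zeroʳ c)
sumOver-scale (true ∷ A)  c f =
  trans (cong (_+_ (c * f zero)) (sumOver-scale A c _)) (sym (*-distribˡ-+ c _ _))
sumOver-scale (false ∷ A) c f =
  trans (+-identityˡ _) (trans (sumOver-scale A c _) (cong (c *_) (sym (+-identityˡ _))))

-- Every constraint of LP(T[U']) is a constraint of LP(T[U]) when U' ⊆ U, so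
-- feasibility passes to subtournaments.
feasible-restrict : ∀ {n} (E : Fin n → Fin n → Set) {U U' : Subset n} {x : Fin n → ℚ} →
                    U' ⊆ U → Feasible E U x → Feasible E U' x
feasible-restrict E U'⊆U (x≥0 , triangle , seven) =
  (λ v → x≥0 v ∘ U'⊆U) ,
  (λ a b c (a∈ , b∈ , c∈ , arcs) → triangle a b c (U'⊆U a∈ , U'⊆U b∈ , U'⊆U c∈ , arcs)) ,
  (λ Q (Q⊆U' , size , noTT5) → seven Q (U'⊆U ∘ Q⊆U' , size , noTT5))

optimal-≤-restriction : ∀ {n} (E : Fin n → Fin n → Set) (w : Fin n → ℚ) {U U' : Subset n}
                        {x x' : Fin n → ℚ} → U' ⊆ U → Optimal E w U' x' → Feasible E U x →
                        objective w U' x' ≤ objective w U' x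
optimal-≤-restriction E w U'⊆U (_ , minimal) feasible = minimal _ (feasible-restrict E U'⊆U feasible)

removal-bound : ∀ {n} (w x : Fin n → ℚ) (c : ℚ) (S U' U : Subset n) → (∀ v → 0ℚ ≤ w v) →
                (∀ v → v ∈ U → 0ℚ ≤ x v) → (∀ v → v ∈ S → c ≤ x v) →
                S ⊆ U → U' ⊆ U → (∀ {v} → v ∈ S → v ∉ U') →
                c * sumOver S w + objective w U' x ≤ objective w U x
removal-bound w x c S U' U w≥0 x≥0 x≥c S⊆U U'⊆U disjoint = begin
  c * sumOver S w + objective w U' x               ≡⟨ cong (_+ objective w U' x) (sumOver-scale S c w) ⟨
  sumOver S (λ v → c * w v) + objective w U' x      ≤⟨ +-monoˡ-≤ _ (sumOver-mono-≤ S _ _ cw≤wx) ⟩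
  objective w S x + objective w U' x               ≤⟨ sumOver-disjoint-≤ S U' U _ S⊆U U'⊆U disjoint wx≥0 ⟩
  objective w U x                                  ∎
  where
  open ≤-Reasoning
  cw≤wx : ∀ v → v ∈ S → c * w v ≤ w v * x v
  cw≤wx v v∈S = subst (_≤ w v * x v) (*-comm (w v) c)
    (*-monoˡ-≤-nonNeg (w v) {{nonNegative (w≥0 v)}} (x≥c v v∈S))
  wx≥0 : ∀ v → v ∈ U → 0ℚ ≤ w v * x v
  wx≥0 v v∈U = subst (_≤ w v * x v) (*-zeroʳ (w v))
    (*-monoˡ-≤-nonNeg (w v) {{nonNegative (w≥0 v)}} (x≥0 v v∈U))

charge : ∀ {k c s a b : ℚ} .{{_ : NonNegative k}} → k * c ≡ 1ℚ →
         c * s + b ≤ a → s ≤ k * (a - b)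
charge {k} {c} {s} {a} {b} kc≡1 cs+b≤a = begin
  s                       ≡⟨ *-identityˡ s ⟨
  1ℚ * s                  ≡⟨ cong (_* s) kc≡1 ⟨
  k * c * s               ≡⟨ *-assoc k c s ⟩
  k * (c * s)             ≡⟨ cong (k *_) cancel ⟨
  k * (c * s + b - b)     ≤⟨ *-monoˡ-≤-nonNeg k (+-monoˡ-≤ (- b) cs+b≤a) ⟩
  k * (a - b)             ∎
  where
  open ≤-Reasoning
  cancel : c * s + b - b ≡ c * s
  cancel = trans (+-assoc (c * s) b (- b)) (trans (cong (_+_ (c * s)) (+-inverseʳ b)) (+-identityʳ (c * s)))

telescope : ∀ k a b d → k * (a - b) + k * (b - d) ≡ k * (a - d)
telescope k a b d = trans (sym (*-distribˡ-+ k (a - b) (b - d))) (cong (k *_) middle)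
  where
  middle : (a - b) + (b - d) ≡ a - d
  middle = begin
    (a - b) + (b - d)   ≡⟨ +-assoc a (- b) (b - d) ⟩
    a + (- b + (b - d)) ≡⟨ cong (_+_ a) (+-assoc (- b) b (- d)) ⟨
    a + ((- b + b) - d) ≡⟨ cong (λ t → a + (t - d)) (+-inverseˡ b) ⟩
    a + (0ℚ - d)        ≡⟨ cong (_+_ a) (+-identityˡ (- d)) ⟩
    a - d               ∎
    where open ≡-Reasoning

module Run {n : ℕ} (E : Fin n → Fin n → Set) (w : Fin n → ℚ) (w≥0 : ∀ v → 0ℚ ≤ w v)
           (x₀ : Fin n → ℚ) where

  OPT₀ : ℚ
  OPT₀ = objective w ⊤ x₀

  Invariant : State n → Set
  Invariant (state F U x) = Feasible E U x × sumOver F w ≤ (+ 7 / 3) * (OPT₀ - objective w U x)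

  removed : ∀ {s s'} → Step E w s s' → Subset n
  removed (step S _ _ _ _ _ _ _) = S

  step-cost : ∀ {F U x F' U' x'} (st : Step E w (state F U x) (state F' U' x')) → Feasible E U x →
              sumOver (removed st) w ≤ (+ 7 / 3) * (objective w U x - objective w U' x')
  step-cost {U = U} {x} (step S U' x' _ _ S-def U'-def optimal) feasible@(x≥0 , _) =
    charge refl (begin
      + 3 / 7 * sumOver S w + objective w U' x'   ≤⟨ +-monoʳ-≤ (+ 3 / 7 * sumOver S w) (optimal-≤-restriction E w U'⊆U optimal feasible) ⟩
      + 3 / 7 * sumOver S w + objective w U' x    ≤⟨ removal-bound w x (+ 3 / 7) S U' U w≥0 x≥0 x≥3/7 S⊆U U'⊆U disjoint ⟩
      objective w U x                             ∎)
    where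
    open ≤-Reasoning
    S⊆U : S ⊆ U
    S⊆U v∈S = proj₁ (Equivalence.to (S-def _) v∈S)
    x≥3/7 : ∀ v → v ∈ S → + 3 / 7 ≤ x v
    x≥3/7 v v∈S = proj₂ (Equivalence.to (S-def v) v∈S)
    U'⊆U─S : U' ⊆ U ─ S
    U'⊆U─S v∈U' = proj₁ (Equivalence.to (U'-def _) v∈U')
    U'⊆U : U' ⊆ U
    U'⊆U = p─q⊆p U S ∘ U'⊆U─S
    disjoint : ∀ {v} → v ∈ S → v ∉ U'
    disjoint v∈S v∈U' = ∈─⇒∉ U S (U'⊆U─S v∈U') v∈S

  step-preserves : ∀ {s s'} → Step E w s s' → Invariant s → Invariant s'
  step-preserves {state F U x} st@(step S U' x' _ _ _ _ optimal) (feasible , paid) =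
    proj₁ optimal , (begin
    sumOver (F ∪ S) w                                          ≤⟨ sumOver-∪-≤ F S w w≥0 ⟩
    sumOver F w + sumOver S w                                  ≤⟨ +-mono-≤ paid (step-cost st feasible) ⟩
    k * (OPT₀ - objective w U x) + k * (objective w U x - objective w U' x')
                                                               ≡⟨ telescope k OPT₀ (objective w U x) (objective w U' x') ⟩
    k * (OPT₀ - objective w U' x')                             ∎)
    where
    open ≤-Reasoning
    k : ℚ
    k = + 7 / 3

  initial-invariant : Optimal E w ⊤ x₀ → Invariant (initial x₀)
  initial-invariant (feasible , _) = feasible , (begin
    sumOver ∅ w              ≡⟨ sumOver-∅ w ⟩
    0ℚ                       ≡⟨ *-zeroʳ (+ 7 / 3) ⟨
    + 7 / 3 * 0ℚ             ≡⟨ cong (+ 7 / 3 *_) (+-inverseʳ OPT₀) ⟨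
    + 7 / 3 * (OPT₀ - OPT₀)  ∎)
    where open ≤-Reasoning

  reachable-invariant : Optimal E w ⊤ x₀ → ∀ {s} → Reachable E w (initial x₀) s → Invariant s
  reachable-invariant optimal here           = initial-invariant optimal
  reachable-invariant optimal (next run st) = step-preserves st (reachable-invariant optimal run)

lemma1 : ∀ {n : ℕ} (E : Fin n → Fin n → Set) → IsTournament E
    → (w : Fin n → ℚ) → (∀ v → 0ℚ ≤ w v)
    → (x₀ : Fin n → ℚ) → Optimal E w ⊤ x₀
    → ∀ F U x → Reachable E w (initial x₀) (state F U x)
    → sumOver F w ≤ (+ 7 / 3) * (objective w ⊤ x₀ - objective w U x)
lemma1 E _ w w≥0 x₀ optimal F U x run =
  proj₂ (Run.reachable-invariant E w w≥0 x₀ optimal run)
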